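{- Let $H$ be a hypergraph, $\sigma$ an ordering of $V(H)$, and let $\sigma'$ be obtained from $\sigma$ by swapping two vertices $u,v$ with $\sigma(u)<\sigma(v)$. Put $p=\sigma(u)$, $q=\sigma(v)$. If $r_{\sigma'}(p)>r_\sigma(p)$ and $r_{\sigma'}(i)\le r_\sigma(i)$ for all $i$ with $p<i\le q$, then the cost of $\sigma'$ is strictly smaller than the cost of $\sigma$.
   Context: A hypergraph $H$ has finite vertex set $V(H)$ and a set $E(H)$ of nonempty subsets of $V(H)$. An ordering is a bijection $\sigma:V(H)\to\{1,\dots,|V(H)|\}$; its cost is $\sum_{e\in E(H)}\min_{v\in e}\sigma(v)$. The effective coverage of position $i$ is $r_\sigma(i)=|\{e\in E(H): \min_{v\in e}\sigma(v)=i\}|$. -}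

module Defs where

open import Data.Nat using (ℕ; zero; suc; _+_; _⊓_)
open import Data.Fin using (Fin; toℕ)
open import Data.Fin.Subset using (Subset; Nonempty)
open import Data.Vec using (lookup)
open import Data.Bool using (true; false)
open import Data.Fin.Permutation using (Permutation′; _⟨$⟩ʳ_; transpose; _∘ₚ_)
open import Data.List using (List; []; _∷_; allFin; foldr; filter; length)
open import Data.List.Relation.Unary.All using (All)
open import Data.List.Relation.Unary.Unique.Propositional using (Unique)
open import Data.Nat using (_≟_)

record Hypergraph (n : ℕ) : Set where
  field
    edges    : List (Subset n)
    nonempty : All Nonempty edges
    distinct : Unique edges
open Hypergraph public

-- An ordering is a bijection V(H) → positions; positions are 1-based:
-- vertex v is at position suc (toℕ (σ ⟨$⟩ʳ v)).
Ordering : ℕ → Set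
Ordering n = Permutation′ n

pos : ∀ {n} → Ordering n → Fin n → ℕ
pos σ v = suc (toℕ (σ ⟨$⟩ʳ v))

-- min over v ∈ e of pos σ v (default value suc n, never reached for nonempty e)
minPos : ∀ {n} → Ordering n → Subset n → ℕ
minPos {n} σ e = foldr step (suc n) (allFin n)
  where
  step : Fin n → ℕ → ℕ
  step v acc with lookup e v
  ... | true  = pos σ v ⊓ acc
  ... | false = acc

cost : ∀ {n} → Hypergraph n → Ordering n → ℕ
cost H σ = foldr (λ e acc → minPos σ e + acc) 0 (edges H)

coverage : ∀ {n} → Hypergraph n → Ordering n → ℕ → ℕ
coverage H σ i = length (filter (λ e → minPos σ e ≟ i) (edges H))

-- σ' obtained from σ by swapping vertices u and v: σ'(w) = σ(τ_{uv} w)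
swapOrd : ∀ {n} → Ordering n → Fin n → Fin n → Ordering n
swapOrd σ u v = transpose u v ∘ₚ σ

-- Swapping u and v only exchanges the positions p = σ(u) and q = σ(v), so an edge keeps its
-- minimum position unless the old and the new minimum both lie in the window [p, q]. Hence the
-- coverages of σ and σ′ have equal sums over the window, and cost σ′ − cost σ is the sum over the
-- window of i (r_σ′(i) − r_σ(i)). Writing the weight i as (i − p − 1) + (p + 1), the second part
-- cancels by the equal sums, and every term of the first is ≤ 0 by hypothesis, strictly so at i = p.
module Submission where

open import Algebra.Properties.CommutativeSemigroup using (interchange)
open import Data.Bool using (Bool; true; false; if_then_else_)
open import Data.Empty using (⊥-elim)
open import Data.Fin using (Fin) renaming (_≟_ to _≟ᶠ_)
open import Data.Fin.Properties using (toℕ<n)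
import Data.Fin.Permutation.Components as PC
open import Data.Fin.Subset using (Subset; Nonempty)
open import Data.List using (List; []; _∷_; foldr; allFin; filter; length)
open import Data.List.Membership.Propositional using (_∈_)
open import Data.List.Membership.Propositional.Properties using (∈-allFin)
open import Data.List.Properties using (foldr-cong)
open import Data.List.Relation.Unary.All as All using (All; []; _∷_)
open import Data.List.Relation.Unary.Any using (here; there)
open import Data.Nat using (ℕ; zero; suc; _+_; _*_; _∸_; _⊓_; _≤_; _<_; _≟_)
open import Data.Nat.Properties
open import Data.Nat.Tactic.RingSolver using (solve-∀)
open import Data.Product using (_×_; _,_; proj₁; ∃-syntax)
open import Data.Sum as Sum using (_⊎_; inj₁; inj₂)
open import Data.Vec using (lookup)
open import Data.Vec.Properties using ([]=⇒lookup)
open import Function using (_∘_)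
open import Relation.Nullary using (does; yes; no)
open import Relation.Nullary.Decidable using (dec-true; dec-false)
open import Relation.Binary.PropositionalEquality

open import Defs

minWhere : {A : Set} → (A → Bool) → (A → ℕ) → ℕ → List A → ℕ
minWhere b φ z = foldr (λ a m → if b a then φ a ⊓ m else m) z

module _ {A : Set} (b : A → Bool) (φ : A → ℕ) (z : ℕ) where

  minWhere-∷-≤ : ∀ a as → minWhere b φ z (a ∷ as) ≤ minWhere b φ z as
  minWhere-∷-≤ a as with b a
  ... | true  = m⊓n≤n _ _
  ... | false = ≤-refl

  minWhere-≤ : ∀ {a} as → a ∈ as → b a ≡ true → minWhere b φ z as ≤ φ a
  minWhere-≤ (a ∷ as) (here refl) ba rewrite ba = m⊓n≤m _ _
  minWhere-≤ (a′ ∷ as) (there a∈as) ba = ≤-trans (minWhere-∷-≤ a′ as) (minWhere-≤ as a∈as ba)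

  minWhere-attained : ∀ as → minWhere b φ z as ≡ z ⊎ ∃[ a ] b a ≡ true × minWhere b φ z as ≡ φ a
  minWhere-attained [] = inj₁ refl
  minWhere-attained (a ∷ as) with b a in ba
  ... | false = minWhere-attained as
  ... | true with ⊓-sel (φ a) (minWhere b φ z as)
  ...   | inj₁ m≡φa = inj₂ (a , ba , m≡φa)
  ...   | inj₂ m≡rest =
    Sum.map (trans m≡rest) (λ (a′ , ba′ , eq) → a′ , ba′ , trans m≡rest eq) (minWhere-attained as)

-- The step function of minPos is local to its where-block; unification recovers it here.
private
  minPos-step : ∀ {n} (σ : Ordering n) (e : Subset n) →
                ∃[ step ] minPos σ e ≡ foldr step (suc n) (allFin n)
  minPos-step σ e = _ , refl

minPos-as-minWhere : ∀ {n} (σ : Ordering n) (e : Subset n) →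
                     minPos σ e ≡ minWhere (lookup e) (pos σ) (suc n) (allFin n)
minPos-as-minWhere {n} σ e = foldr-cong step-spec refl (allFin n)
  where
  step-spec : ∀ v m → proj₁ (minPos-step σ e) v m ≡ (if lookup e v then pos σ v ⊓ m else m)
  step-spec v m with lookup e v
  ... | true  = refl
  ... | false = refl

module _ {n} (σ : Ordering n) (e : Subset n) where

  minPos-≤ : ∀ {w} → lookup e w ≡ true → minPos σ e ≤ pos σ w
  minPos-≤ {w} ew = ≤-trans (≤-reflexive (minPos-as-minWhere σ e))
                             (minWhere-≤ (lookup e) (pos σ) (suc n) (allFin n) (∈-allFin w) ew)

  minPos-attained : Nonempty e → ∃[ a ] lookup e a ≡ true × minPos σ e ≡ pos σ a
  minPos-attained (w , w∈e)
    with minWhere-attained (lookup e) (pos σ) (suc n) (allFin n)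
  ... | inj₂ (a , ea , eq) = a , ea , trans (minPos-as-minWhere σ e) eq
  ... | inj₁ eq = ⊥-elim (1+n≰n (≤-trans n<pos (toℕ<n _)))
    where
    n<pos : n < pos σ w
    n<pos = subst (_≤ pos σ w) (trans (minPos-as-minWhere σ e) eq) (minPos-≤ ([]=⇒lookup w∈e))

_∈[_,_] : ℕ → ℕ → ℕ → Set
x ∈[ p , q ] = p ≤ x × x ≤ q

SameOutside : ℕ → ℕ → ℕ → ℕ → Set
SameOutside p q x y = x ≡ y ⊎ (x ∈[ p , q ] × y ∈[ p , q ])

transpose-cases : ∀ {n} (u v w : Fin n) →
  (w ≡ u × PC.transpose u v w ≡ v) ⊎ (w ≡ v × PC.transpose u v w ≡ u) ⊎ PC.transpose u v w ≡ w
transpose-cases u v w with w ≟ᶠ u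
... | yes w≡u = inj₁ (w≡u , refl)
... | no _ with w ≟ᶠ v
...   | yes w≡v = inj₂ (inj₁ (w≡v , refl))
...   | no _    = inj₂ (inj₂ refl)

pos-swapOrd : ∀ {n} (σ : Ordering n) (u v : Fin n) → pos σ u ≤ pos σ v →
              ∀ w → SameOutside (pos σ u) (pos σ v) (pos σ w) (pos (swapOrd σ u v) w)
pos-swapOrd σ u v p≤q w with transpose-cases u v w
... | inj₁ (refl , τw≡v)        rewrite τw≡v = inj₂ ((≤-refl , p≤q) , (p≤q , ≤-refl))
... | inj₂ (inj₁ (refl , τw≡u)) rewrite τw≡u = inj₂ ((p≤q , ≤-refl) , (≤-refl , p≤q))
... | inj₂ (inj₂ τw≡w)          = inj₁ (cong (pos σ) (sym τw≡w))

-- Used with x₁ = σ a, y₁ = τ a, x₂ = σ b, y₂ = τ b, where a and b minimise σ and τ on an edge.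
sameOutside-min : ∀ {p q x₁ y₁ x₂ y₂} → x₁ ≤ x₂ → y₂ ≤ y₁ →
                  SameOutside p q x₁ y₁ → SameOutside p q x₂ y₂ → SameOutside p q x₁ y₂
sameOutside-min x₁≤x₂ y₂≤y₁ (inj₁ refl) (inj₁ refl) = inj₁ (≤-antisym x₁≤x₂ y₂≤y₁)
sameOutside-min x₁≤x₂ y₂≤y₁ (inj₂ (x₁∈ , _)) (inj₂ (_ , y₂∈)) = inj₂ (x₁∈ , y₂∈)
sameOutside-min x₁≤x₂ y₂≤y₁ (inj₁ refl) (inj₂ ((_ , x₂≤q) , y₂∈@(p≤y₂ , _))) =
  inj₂ ((≤-trans p≤y₂ y₂≤y₁ , ≤-trans x₁≤x₂ x₂≤q) , y₂∈)
sameOutside-min x₁≤x₂ y₂≤y₁ (inj₂ (x₁∈@(p≤x₁ , _) , (_ , y₁≤q))) (inj₁ refl) =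
  inj₂ (x₁∈ , (≤-trans p≤x₁ x₁≤x₂ , ≤-trans y₂≤y₁ y₁≤q))

minPos-sameOutside : ∀ {n p q} (σ τ : Ordering n) → (∀ w → SameOutside p q (pos σ w) (pos τ w)) →
                     ∀ (e : Subset n) → Nonempty e → SameOutside p q (minPos σ e) (minPos τ e)
minPos-sameOutside {p = p} {q} σ τ same e ne
  with minPos-attained σ e ne | minPos-attained τ e ne
... | a , ea , mσ≡σa | b , eb , mτ≡τb =
  subst₂ (SameOutside p q) (sym mσ≡σa) (sym mτ≡τb)
    (sameOutside-min (subst (_≤ pos σ b) mσ≡σa (minPos-≤ σ e eb))
                     (subst (_≤ pos τ a) mτ≡τb (minPos-≤ τ e ea))
                     (same a) (same b))

windowSum : ℕ → ℕ → (ℕ → ℕ) → ℕ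
windowSum p zero    h = h p
windowSum p (suc d) h = h p + windowSum (suc p) d h

windowSum-cong : ∀ p d {h g : ℕ → ℕ} → (∀ i → h i ≡ g i) → windowSum p d h ≡ windowSum p d g
windowSum-cong p zero    h≗g = h≗g p
windowSum-cong p (suc d) h≗g = cong₂ _+_ (h≗g p) (windowSum-cong (suc p) d h≗g)

windowSum-+ : ∀ p d (h g : ℕ → ℕ) →
              windowSum p d (λ i → h i + g i) ≡ windowSum p d h + windowSum p d g
windowSum-+ p zero    h g = refl
windowSum-+ p (suc d) h g =
  trans (cong (h p + g p +_) (windowSum-+ (suc p) d h g))
        (interchange +-commutativeSemigroup (h p) (g p) _ _)

windowSum-*ˡ : ∀ p d c (h : ℕ → ℕ) → windowSum p d (λ i → c * h i) ≡ c * windowSum p d h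
windowSum-*ˡ p zero    c h = refl
windowSum-*ˡ p (suc d) c h =
  trans (cong (c * h p +_) (windowSum-*ˡ (suc p) d c h)) (sym (*-distribˡ-+ c (h p) _))

windowSum-mono-≤ : ∀ p d {h g : ℕ → ℕ} → (∀ i → i ∈[ p , p + d ] → h i ≤ g i) →
                   windowSum p d h ≤ windowSum p d g
windowSum-mono-≤ p zero    h≤g = h≤g p (≤-refl , ≤-reflexive (sym (+-identityʳ p)))
windowSum-mono-≤ p (suc d) h≤g =
  +-mono-≤ (h≤g p (≤-refl , m≤m+n p (suc d)))
           (windowSum-mono-≤ (suc p) d λ i (p<i , i≤) →
              h≤g i (<⇒≤ p<i , subst (i ≤_) (sym (+-suc p d)) i≤))

windowSum-mono-< : ∀ p d {h g : ℕ → ℕ} → h p < g p →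
                   (∀ i → i ∈[ suc p , p + d ] → h i ≤ g i) →
                   windowSum p d h < windowSum p d g
windowSum-mono-< p zero    hp<gp _   = hp<gp
windowSum-mono-< p (suc d) hp<gp h≤g =
  +-mono-<-≤ hp<gp (windowSum-mono-≤ (suc p) d λ i (p<i , i≤) →
                      h≤g i (p<i , subst (i ≤_) (sym (+-suc p d)) i≤))

δ : ℕ → ℕ → ℕ
δ x i = if does (x ≟ i) then 1 else 0

δ-≢ : ∀ {x i} → x ≢ i → δ x i ≡ 0
δ-≢ {x} {i} x≢i rewrite dec-false (x ≟ i) x≢i = refl

δ-refl : ∀ x → δ x x ≡ 1
δ-refl x rewrite dec-true (x ≟ x) refl = refl

module _ (w : ℕ → ℕ) where

  weighted-δ-≢ : ∀ {x i} → x ≢ i → w i * δ x i ≡ 0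
  weighted-δ-≢ {i = i} x≢i = trans (cong (w i *_) (δ-≢ x≢i)) (*-zeroʳ (w i))

  weighted-δ-refl : ∀ x → w x * δ x x ≡ w x
  weighted-δ-refl x = trans (cong (w x *_) (δ-refl x)) (*-identityʳ (w x))

  windowSum-δ-< : ∀ {x} p d → x < p → windowSum p d (λ i → w i * δ x i) ≡ 0
  windowSum-δ-< p zero    x<p = weighted-δ-≢ (<⇒≢ x<p)
  windowSum-δ-< p (suc d) x<p =
    cong₂ _+_ (weighted-δ-≢ (<⇒≢ x<p)) (windowSum-δ-< (suc p) d (m<n⇒m<1+n x<p))

  windowSum-δ-∈ : ∀ {x} p d → x ∈[ p , p + d ] → windowSum p d (λ i → w i * δ x i) ≡ w x
  windowSum-δ-∈ {x} p d (p≤x , x≤p+d) with m≤n⇒m<n∨m≡n p≤x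
  windowSum-δ-∈ p zero    _ | inj₂ refl = weighted-δ-refl p
  windowSum-δ-∈ p (suc d) _ | inj₂ refl =
    trans (cong₂ _+_ (weighted-δ-refl p) (windowSum-δ-< (suc p) d ≤-refl)) (+-identityʳ (w p))
  windowSum-δ-∈ p zero    (_ , x≤p+0) | inj₁ p<x =
    ⊥-elim (<⇒≱ p<x (subst (_ ≤_) (+-identityʳ p) x≤p+0))
  windowSum-δ-∈ {x} p (suc d) (_ , x≤p+d) | inj₁ p<x =
    cong₂ _+_ (weighted-δ-≢ (≢-sym (<⇒≢ p<x)))
              (windowSum-δ-∈ (suc p) d (p<x , subst (x ≤_) (+-suc p d) x≤p+d))

  windowSum-δ-balance : ∀ {x y} p d → SameOutside p (p + d) x y →
    w y + windowSum p d (λ i → w i * δ x i) ≡ w x + windowSum p d (λ i → w i * δ y i)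
  windowSum-δ-balance p d (inj₁ refl) = refl
  windowSum-δ-balance {x} {y} p d (inj₂ (x∈ , y∈))
    rewrite windowSum-δ-∈ p d x∈ | windowSum-δ-∈ p d y∈ = +-comm (w y) (w x)

count : {A : Set} → (A → ℕ) → ℕ → List A → ℕ
count f i as = length (filter (λ a → f a ≟ i) as)

sumOver : {A : Set} → (A → ℕ) → List A → ℕ
sumOver f = foldr (λ a s → f a + s) 0

count-∷ : ∀ {A : Set} (f : A → ℕ) i a as → count f i (a ∷ as) ≡ δ (f a) i + count f i as
count-∷ f i a as with does (f a ≟ i)
... | true  = refl
... | false = refl

module _ {A : Set} (w : ℕ → ℕ) (p d : ℕ) where

  windowSum-count-∷ : ∀ (f : A → ℕ) a as →
    windowSum p d (λ i → w i * count f i (a ∷ as))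
      ≡ windowSum p d (λ i → w i * δ (f a) i) + windowSum p d (λ i → w i * count f i as)
  windowSum-count-∷ f a as =
    trans (windowSum-cong p d (λ i → trans (cong (w i *_) (count-∷ f i a as)) (*-distribˡ-+ (w i) _ _)))
          (windowSum-+ p d _ _)

  windowSum-count-balance : ∀ {f g : A → ℕ} as → All (λ a → SameOutside p (p + d) (f a) (g a)) as →
    sumOver (w ∘ g) as + windowSum p d (λ i → w i * count f i as)
      ≡ sumOver (w ∘ f) as + windowSum p d (λ i → w i * count g i as)
  windowSum-count-balance [] [] = refl
  windowSum-count-balance {f} {g} (a ∷ as) (fa≈ga ∷ f≈g) = begin
    (w (g a) + sumOver (w ∘ g) as) + windowSum p d (λ i → w i * count f i (a ∷ as))
      ≡⟨ cong ((w (g a) + sumOver (w ∘ g) as) +_) (windowSum-count-∷ f a as) ⟩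
    (w (g a) + sumOver (w ∘ g) as) + (Δ f + W f)
      ≡⟨ interchange +-commutativeSemigroup (w (g a)) _ _ _ ⟩
    (w (g a) + Δ f) + (sumOver (w ∘ g) as + W f)
      ≡⟨ cong₂ _+_ (windowSum-δ-balance w p d fa≈ga) (windowSum-count-balance as f≈g) ⟩
    (w (f a) + Δ g) + (sumOver (w ∘ f) as + W g)
      ≡⟨ interchange +-commutativeSemigroup (w (f a)) _ _ _ ⟩
    (w (f a) + sumOver (w ∘ f) as) + (Δ g + W g)
      ≡⟨ cong ((w (f a) + sumOver (w ∘ f) as) +_) (windowSum-count-∷ g a as) ⟨
    (w (f a) + sumOver (w ∘ f) as) + windowSum p d (λ i → w i * count g i (a ∷ as))
      ∎
    where
    open ≡-Reasoning
    Δ W : (A → ℕ) → ℕ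
    Δ h = windowSum p d (λ i → w i * δ (h a) i)
    W h = windowSum p d (λ i → w i * count h i as)

rearrangement-gap : ∀ {a b c d} → a ≤ b → c ≤ d → a * d + b * c + (b ∸ a) * (d ∸ c) ≡ a * c + b * d
rearrangement-gap {a} {b} {c} {d} a≤b c≤d with b ∸ a | m+[n∸m]≡n a≤b | d ∸ c | m+[n∸m]≡n c≤d
... | s | refl | t | refl = gap a c s t
  where
  gap : ∀ a c s t → a * (c + t) + (a + s) * c + s * t ≡ a * c + (a + s) * (c + t)
  gap = solve-∀

rearrangement-≤ : ∀ {a b c d} → a ≤ b → c ≤ d → a * d + b * c ≤ a * c + b * d
rearrangement-≤ {a} {b} {c} {d} a≤b c≤d =
  subst (a * d + b * c ≤_) (rearrangement-gap a≤b c≤d) (m≤m+n _ _)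

rearrangement-< : ∀ {a b c d} → a < b → c < d → a * d + b * c < a * c + b * d
rearrangement-< {a} {b} {c} {d} a<b c<d =
  subst (a * d + b * c <_) (rearrangement-gap (<⇒≤ a<b) (<⇒≤ c<d))
        (m<m+n _ (*-mono-< (m<n⇒0<n∸m a<b) (m<n⇒0<n∸m c<d)))

-- Termwise after adding (p + 1) times the equal totals: the rearrangement inequality, strict at i = p.
windowSum-weighted-< : ∀ p d (C C′ : ℕ → ℕ) → C p < C′ p →
                       (∀ i → i ∈[ suc p , p + d ] → C′ i ≤ C i) →
                       windowSum p d C ≡ windowSum p d C′ →
                       windowSum p d (λ i → i * C′ i) < windowSum p d (λ i → i * C i)
windowSum-weighted-< p d C C′ Cp<C′p C′≤C total = +-cancelʳ-< _ _ _ (begin-strict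
  Σi C′ + suc p * windowSum p d C                 ≡⟨ split C′ C ⟨
  windowSum p d (λ i → i * C′ i + suc p * C i)    <⟨ windowSum-mono-< p d at-p beyond-p ⟩
  windowSum p d (λ i → i * C i + suc p * C′ i)    ≡⟨ split C C′ ⟩
  Σi C + suc p * windowSum p d C′                 ≡⟨ cong (λ t → Σi C + suc p * t) total ⟨
  Σi C + suc p * windowSum p d C                  ∎)
  where
  open ≤-Reasoning
  Σi : (ℕ → ℕ) → ℕ
  Σi h = windowSum p d (λ i → i * h i)
  split : ∀ h g → windowSum p d (λ i → i * h i + suc p * g i) ≡ Σi h + suc p * windowSum p d g
  split h g = trans (windowSum-+ p d _ _) (cong (Σi h +_) (windowSum-*ˡ p d (suc p) g))
  at-p : p * C′ p + suc p * C p < p * C p + suc p * C′ p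
  at-p = rearrangement-< (n<1+n p) Cp<C′p
  beyond-p : ∀ i → i ∈[ suc p , p + d ] → i * C′ i + suc p * C i ≤ i * C i + suc p * C′ i
  beyond-p i i∈@(p<i , _) = subst₂ _≤_ (+-comm (suc p * C i) (i * C′ i)) (+-comm (suc p * C′ i) (i * C i))
                                    (rearrangement-≤ p<i (C′≤C i i∈))

corollary9 : ∀ {n} (H : Hypergraph n) (σ : Ordering n) (u v : Fin n) →
    pos σ u < pos σ v →
    coverage H σ (pos σ u) < coverage H (swapOrd σ u v) (pos σ u) →
    (∀ (i : ℕ) → pos σ u < i → i ≤ pos σ v →
    coverage H (swapOrd σ u v) i ≤ coverage H σ i) →
    cost H (swapOrd σ u v) < cost H σ
corollary9 H σ u v p<q coverage-p coverage-beyond-p = +-cancelʳ-< _ _ _ (begin-strict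
  cost H σ′ + windowSum p d (λ i → i * C i)  ≡⟨ windowSum-count-balance (λ i → i) p d (edges H) shifts ⟩
  cost H σ + windowSum p d (λ i → i * C′ i)  <⟨ +-monoʳ-< (cost H σ) weighted ⟩
  cost H σ + windowSum p d (λ i → i * C i)   ∎)
  where
  open ≤-Reasoning
  σ′ = swapOrd σ u v
  p = pos σ u
  d = pos σ v ∸ p
  p+d≡q : p + d ≡ pos σ v
  p+d≡q = m+[n∸m]≡n (<⇒≤ p<q)
  C C′ : ℕ → ℕ
  C = coverage H σ
  C′ = coverage H σ′
  shifts : All (λ e → SameOutside p (p + d) (minPos σ e) (minPos σ′ e)) (edges H)
  shifts = All.map (λ {e} → minPos-sameOutside σ σ′ pos-shifts e) (nonempty H)
    where
    pos-shifts : ∀ w → SameOutside p (p + d) (pos σ w) (pos σ′ w)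
    pos-shifts = subst (λ q → ∀ w → SameOutside p q (pos σ w) (pos σ′ w)) (sym p+d≡q)
                       (pos-swapOrd σ u v (<⇒≤ p<q))
  total : windowSum p d C ≡ windowSum p d C′
  total = subst₂ _≡_ (windowSum-cong p d (*-identityˡ ∘ C)) (windowSum-cong p d (*-identityˡ ∘ C′))
                 (+-cancelˡ-≡ (sumOver (λ _ → 1) (edges H)) _ _
                   (windowSum-count-balance (λ _ → 1) p d (edges H) shifts))
  weighted : windowSum p d (λ i → i * C′ i) < windowSum p d (λ i → i * C i)
  weighted = windowSum-weighted-< p d C C′ coverage-p
               (λ i (p<i , i≤p+d) → coverage-beyond-p i p<i (subst (i ≤_) p+d≡q i≤p+d)) total
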